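{- A bipartite quiver $Q$ is recurrent if and only if for any two vertices $u,v$ of the same color, the number of directed paths of length $2$ from $u$ to $v$ equals the number of directed paths of length $2$ from $v$ to $u$.
   Context: A quiver is a finite directed graph without loops and directed 2-cycles (multiple arrows allowed; paths are counted with multiplicity of arrows). Mutation $\mu_v$: for each pair of arrows $u\to v$, $v\to w$ add an arrow $u\to w$; reverse all arrows incident to $v$; then repeatedly remove both arrows of any directed 2-cycle. $Q$ is bipartite with bipartition $\epsilon:\mathrm{Vert}(Q)\to\{0,1\}$ ($\epsilon_u\neq\epsilon_v$ for every arrow between $u$ and $v$); $\epsilon=1$ vertices are black, $\epsilon=0$ white. $\mu_\bullet$ (resp. $\mu_\circ$) is the composition of mutations at all black (resp. white) vertices. $Q$ is recurrent if each of $\mu_\bullet(Q)$ and $\mu_\circ(Q)$ equals $Q$ with all arrows reversed. -}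

module Defs where

open import Data.Nat using (ℕ; zero; suc; _+_; _*_; _∸_)
open import Data.Fin using (Fin; _≟_)
import Data.Fin as Fin
open import Data.Bool using (Bool; true; false; if_then_else_; not; _∨_)
open import Data.List using (List; foldl; allFin)
open import Data.Product using (_×_)
open import Data.Sum using (_⊎_)
open import Relation.Nullary.Decidable using (⌊_⌋)
open import Relation.Binary.PropositionalEquality using (_≡_; _≢_)

-- A quiver on the vertex set Fin n, given by its arrow multiplicities:
-- Q u v = number of arrows u → v.
Quiver : ℕ → Set
Quiver n = Fin n → Fin n → ℕ

IsQuiver : ∀ {n} → Quiver n → Set
IsQuiver {n} Q = (∀ (v : Fin n) → Q v v ≡ 0) × (∀ (u v : Fin n) → Q u v ≡ 0 ⊎ Q v u ≡ 0)

-- ε is a bipartition: every arrow joins vertices of different colours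
-- (true = 1 = black, false = 0 = white)
IsBipartition : ∀ {n} → Quiver n → (Fin n → Bool) → Set
IsBipartition {n} Q ε = ∀ (u v : Fin n) → Q u v ≢ 0 → ε u ≢ ε v

-- Mutation at vertex v: compose arrows through v, reverse arrows at v,
-- then cancel 2-cycles (net count of arrows between a and b).
mutate : ∀ {n} → Fin n → Quiver n → Quiver n
mutate v Q a b =
  if ⌊ a ≟ v ⌋ ∨ ⌊ b ≟ v ⌋
  then Q b a
  else (Q a b + Q a v * Q v b) ∸ (Q b a + Q b v * Q v a)

mutateAll : ∀ {n} → (Fin n → Bool) → Quiver n → Quiver n
mutateAll {n} p Q = foldl (λ R v → if p v then mutate v R else R) Q (allFin n)

mu-black : ∀ {n} → (Fin n → Bool) → Quiver n → Quiver n
mu-black ε = mutateAll ε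

mu-white : ∀ {n} → (Fin n → Bool) → Quiver n → Quiver n
mu-white ε = mutateAll (λ v → not (ε v))

opposite : ∀ {n} → Quiver n → Quiver n
opposite Q u v = Q v u

_≐_ : ∀ {n} → Quiver n → Quiver n → Set
_≐_ {n} Q R = ∀ (u v : Fin n) → Q u v ≡ R u v

Recurrent : ∀ {n} → Quiver n → (Fin n → Bool) → Set
Recurrent Q ε = (mu-black ε Q ≐ opposite Q) × (mu-white ε Q ≐ opposite Q)

sumFin : ∀ {n} → (Fin n → ℕ) → ℕ
sumFin {zero} f = 0
sumFin {suc n} f = f Fin.zero + sumFin (λ i → f (Fin.suc i))

paths2 : ∀ {n} → Quiver n → Fin n → Fin n → ℕ
paths2 Q u v = sumFin (λ w → Q u w * Q w v)

-- Fix a colour class C = {w | c w ≡ true} of a bipartite quiver Q.  Vertices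
-- of C are pairwise non-adjacent, so after mutating at the vertices of a set
-- D ⊆ C one at a time the quiver has a closed form, `expected D`: arrows with
-- an endpoint in D are reversed, and between a, b ∉ D the number of arrows
-- a → b is the surplus of  Q a b + #{2-paths a → w → b, w ∈ D}  over the same
-- count for b → a.  A single mutation at a fresh vertex of C turns the closed
-- form for D into the one for D ∪ {v} (`mutation-step`); induction along the
-- vertex list traversed by `mutateAll` then gives  mutateAll c Q = expected C.
-- Reading this off: mutateAll c Q agrees with the opposite quiver on every
-- pair touching C, and has  paths2 a b ∸ paths2 b a  arrows a → b for a, b ∉ C.
-- So mutateAll c Q is the opposite quiver iff length-2 path counts are
-- symmetric on the other colour class.  Taking c = ε (for μ•) and c = not ∘ ε
-- (for μ∘) yields the theorem.
module Submission where

open import Defs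
open import Data.Nat using (ℕ; zero; suc; _+_; _*_; _∸_)
open import Data.Nat.Properties
  using (+-identityʳ; +-assoc; 0∸n≡0; *-zeroʳ; n∸n≡0; m∸n≡0⇒m≤n; ≤-antisym; +-0-commutativeMonoid)
  renaming (_≟_ to _≟ℕ_)
open import Data.Fin using (Fin; _≟_) renaming (zero to fzero; suc to fsuc)
open import Data.Bool using (Bool; true; false; if_then_else_; not; _∨_; _∧_)
open import Data.Bool.Properties using (not-injective; ∨-identityʳ; ∨-zeroʳ; ∨-comm; ∧-identityʳ; ∧-zeroʳ)
open import Data.List using (List; []; _∷_; foldl; allFin)
import Data.List.Membership.DecPropositional as DecMembership
open import Data.List.Membership.Propositional.Properties using (∈-allFin)
open import Data.List.Relation.Unary.Unique.Propositional using (Unique)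
open import Data.List.Relation.Unary.Unique.Propositional.Properties using (allFin⁺)
open import Data.List.Relation.Unary.AllPairs using (_∷_)
import Data.List.Relation.Unary.All as All
open import Data.Product using (_×_; _,_; proj₁; proj₂)
open import Data.Sum using (_⊎_; inj₁; inj₂; swap)
open import Function.Base using (_∘_)
open import Function.Bundles using (_⇔_; mk⇔; Equivalence)
open import Relation.Nullary using (Dec; yes; no; contradiction)
open import Relation.Nullary.Decidable using (does; dec-true; dec-false; decidable-stable)
open import Relation.Binary.PropositionalEquality
open import Algebra.Properties.CommutativeMonoid.Sum +-0-commutativeMonoid
  using (sum; sum-cong-≗; sum-replicate-zero; ∑-distrib-+)

open ≡-Reasoning

sumFin≡sum : ∀ {n} (f : Fin n → ℕ) → sumFin f ≡ sum f
sumFin≡sum {zero} f = refl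
sumFin≡sum {suc n} f = cong (f fzero +_) (sumFin≡sum (f ∘ fsuc))

sumFin-cong : ∀ {n} {f g : Fin n → ℕ} → (∀ i → f i ≡ g i) → sumFin f ≡ sumFin g
sumFin-cong {f = f} {g} f≗g = begin
  sumFin f  ≡⟨ sumFin≡sum f ⟩
  sum f     ≡⟨ sum-cong-≗ f≗g ⟩
  sum g     ≡⟨ sumFin≡sum g ⟨
  sumFin g  ∎

sumFin-zero : ∀ {n} {f : Fin n → ℕ} → (∀ i → f i ≡ 0) → sumFin f ≡ 0
sumFin-zero {n} {f} f≗0 = begin
  sumFin f              ≡⟨ sumFin-cong f≗0 ⟩
  sumFin {n} (λ _ → 0)  ≡⟨ sumFin≡sum {n} (λ _ → 0) ⟩
  sum {n} (λ _ → 0)     ≡⟨ sum-replicate-zero n ⟩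
  0                     ∎

sumFin-+ : ∀ {n} (f g : Fin n → ℕ) → sumFin (λ i → f i + g i) ≡ sumFin f + sumFin g
sumFin-+ f g = begin
  sumFin (λ i → f i + g i)  ≡⟨ sumFin≡sum (λ i → f i + g i) ⟩
  sum (λ i → f i + g i)     ≡⟨ ∑-distrib-+ f g ⟩
  sum f + sum g             ≡⟨ cong₂ _+_ (sumFin≡sum f) (sumFin≡sum g) ⟨
  sumFin f + sumFin g       ∎

sumFin-single : ∀ {n} (f : Fin n → ℕ) (v : Fin n) →
                sumFin (λ i → if does (i ≟ v) then f i else 0) ≡ f v
sumFin-single {suc n} f fzero = begin
  f fzero + sumFin (λ i → if does (fsuc i ≟ fzero) then f (fsuc i) else 0)
    ≡⟨ cong (f fzero +_) (sumFin-zero {n} (λ _ → refl)) ⟩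
  f fzero + 0
    ≡⟨ +-identityʳ (f fzero) ⟩
  f fzero ∎
sumFin-single {suc n} f (fsuc v) = trans (sumFin-cong shift) (sumFin-single (f ∘ fsuc) v)
  where
  shift : ∀ i → (if does (fsuc i ≟ fsuc v) then f (fsuc i) else 0)
              ≡ (if does (i ≟ v) then f (fsuc i) else 0)
  shift i with i ≟ v
  ... | yes refl = refl
  ... | no _ = refl

-- Cancelling X against Y before or after adding α and β gives the same net count.
cancel-then-add : ∀ X Y α β → ((X ∸ Y) + α) ∸ ((Y ∸ X) + β) ≡ (X + α) ∸ (Y + β)
cancel-then-add zero    zero    α β = refl
cancel-then-add zero    (suc Y) α β = refl
cancel-then-add (suc X) zero    α β = refl
cancel-then-add (suc X) (suc Y) α β = cancel-then-add X Y α β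

∸-by-zero-side : ∀ {x y} → x ≡ 0 ⊎ y ≡ 0 → x ∸ y ≡ x
∸-by-zero-side {y = y} (inj₁ refl) = 0∸n≡0 y
∸-by-zero-side (inj₂ refl) = refl

net-arrows : ∀ {n} {Q : Quiver n} → IsQuiver Q → ∀ a b → Q a b ∸ Q b a ≡ Q a b
net-arrows (_ , no-2-cycle) a b = ∸-by-zero-side (no-2-cycle a b)

monochromatic-no-arrow : ∀ {n} {Q : Quiver n} {ε : Fin n → Bool} → IsBipartition Q ε →
                         ∀ {x y} → ε x ≡ ε y → Q x y ≡ 0
monochromatic-no-arrow {Q = Q} bip {x} {y} same =
  decidable-stable (Q x y ≟ℕ 0) (λ Qxy≢0 → bip x y Qxy≢0 same)

mutate-source : ∀ {n} (v : Fin n) (R : Quiver n) b → mutate v R v b ≡ R b v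
mutate-source v R b with v ≟ v
... | yes _ = refl
... | no v≢v = contradiction refl v≢v

mutate-target : ∀ {n} (v : Fin n) (R : Quiver n) a → mutate v R a v ≡ R v a
mutate-target v R a with a ≟ v
... | yes refl = refl
... | no _ with v ≟ v
...   | yes _ = refl
...   | no v≢v = contradiction refl v≢v

mutate-away : ∀ {n} {v a b : Fin n} (R : Quiver n) → a ≢ v → b ≢ v →
              mutate v R a b ≡ (R a b + R a v * R v b) ∸ (R b a + R b v * R v a)
mutate-away {v = v} {a} {b} R a≢v b≢v with a ≟ v | b ≟ v
... | yes a≡v | _ = contradiction a≡v a≢v
... | no _ | yes b≡v = contradiction b≡v b≢v
... | no _ | no _ = refl

module ColourClass {n} (Q : Quiver n) (c : Fin n → Bool) (isQ : IsQuiver Q) (bip : IsBipartition Q c) where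

  open DecMembership (_≟_ {n}) using (_∈?_)

  no-arrow : ∀ {x y} → c x ≡ c y → Q x y ≡ 0
  no-arrow = monochromatic-no-arrow bip

  InClass : (Fin n → Bool) → Set
  InClass d = ∀ w → d w ≡ true → c w ≡ true

  reversed : (Fin n → Bool) → Fin n → Fin n → ℕ
  reversed d a b = if d a ∨ d b then Q b a else Q a b

  through : (Fin n → Bool) → Fin n → Fin n → ℕ
  through d a b = sumFin (λ w → if d w then Q a w * Q w b else 0)

  -- Arrows a → b before cancellation of 2-cycles.
  weight : (Fin n → Bool) → Fin n → Fin n → ℕ
  weight d a b = reversed d a b + through d a b

  -- The quiver obtained by mutating Q at the vertices of D ⊆ C.
  expected : (Fin n → Bool) → Quiver n
  expected d a b = weight d a b ∸ weight d b a

  reversed-endpoints : ∀ d d' {a b} → d a ≡ d' a → d b ≡ d' b → reversed d a b ≡ reversed d' a b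
  reversed-endpoints d d' {a} {b} = cong₂ (λ x y → if x ∨ y then Q b a else Q a b)

  reversed-net : ∀ d a b → reversed d a b ∸ reversed d b a ≡ reversed d a b
  reversed-net d a b rewrite ∨-comm (d b) (d a) with d a ∨ d b
  ... | true = net-arrows isQ b a
  ... | false = net-arrows isQ a b

  reversed-member : ∀ d a b → d a ≡ true ⊎ d b ≡ true → reversed d a b ≡ Q b a
  reversed-member d a b (inj₁ da) rewrite da = refl
  reversed-member d a b (inj₂ db) rewrite db | ∨-zeroʳ (d a) = refl

  reversed-fresh : ∀ {d v} → InClass d → c v ≡ true → d v ≡ false →
                   ∀ a → reversed d a v ≡ Q a v × reversed d v a ≡ Q v a
  reversed-fresh {d} {v} sub cv dv a rewrite dv with d a in da
  ... | true = both-zero , sym both-zero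
    where
    both-zero : Q v a ≡ Q a v
    both-zero = trans (no-arrow (trans cv (sym (sub a da)))) (sym (no-arrow (trans (sub a da) (sym cv))))
  ... | false = refl , refl

  -- No 2-path through C starts or ends in C.
  through-vanishes : ∀ {d} a b → InClass d → c a ≡ true ⊎ c b ≡ true → through d a b ≡ 0
  through-vanishes {d} a b sub touch = sumFin-zero vanish
    where
    vanish : ∀ w → (if d w then Q a w * Q w b else 0) ≡ 0
    vanish w with d w in dw
    ... | false = refl
    ... | true = vanish-middle touch
      where
      vanish-middle : c a ≡ true ⊎ c b ≡ true → Q a w * Q w b ≡ 0
      vanish-middle (inj₁ ca) = cong (_* Q w b) (no-arrow (trans ca (sym (sub w dw))))
      vanish-middle (inj₂ cb) =
        trans (cong (Q a w *_) (no-arrow (trans (sub w dw) (sym cb)))) (*-zeroʳ (Q a w))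

  expected-touching : ∀ {d} a b → InClass d → c a ≡ true ⊎ c b ≡ true →
                      expected d a b ≡ reversed d a b
  expected-touching {d} a b sub touch = begin
    (reversed d a b + through d a b) ∸ (reversed d b a + through d b a)
      ≡⟨ cong₂ (λ s t → (reversed d a b + s) ∸ (reversed d b a + t))
               (through-vanishes a b sub touch) (through-vanishes b a sub (swap touch)) ⟩
    (reversed d a b + 0) ∸ (reversed d b a + 0)
      ≡⟨ cong₂ _∸_ (+-identityʳ (reversed d a b)) (+-identityʳ (reversed d b a)) ⟩
    reversed d a b ∸ reversed d b a
      ≡⟨ reversed-net d a b ⟩
    reversed d a b ∎

  expected-member : ∀ {d x} → InClass d → d x ≡ true →
                    ∀ y → expected d x y ≡ Q y x × expected d y x ≡ Q x y
  expected-member {d} {x} sub dx y =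
    trans (expected-touching x y sub (inj₁ (sub x dx))) (reversed-member d x y (inj₁ dx)) ,
    trans (expected-touching y x sub (inj₂ (sub x dx))) (reversed-member d y x (inj₂ dx))

  expected-fresh : ∀ {d v} → InClass d → c v ≡ true → d v ≡ false →
                   ∀ a → expected d a v ≡ Q a v × expected d v a ≡ Q v a
  expected-fresh {v = v} sub cv dv a =
    trans (expected-touching a v sub (inj₂ cv)) (proj₁ (reversed-fresh sub cv dv a)) ,
    trans (expected-touching v a sub (inj₁ cv)) (proj₂ (reversed-fresh sub cv dv a))

  expected-cong : ∀ d d' → (∀ w → d w ≡ d' w) → expected d ≐ expected d'
  expected-cong d d' d≗d' a b = cong₂ _∸_ (same-weight a b) (same-weight b a)
    where
    same-weight : ∀ x y → weight d x y ≡ weight d' x y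
    same-weight x y = cong₂ _+_ (reversed-endpoints d d' (d≗d' x) (d≗d' y))
      (sumFin-cong (λ w → cong (λ t → if t then Q x w * Q w y else 0) (d≗d' w)))

  expected-empty : Q ≐ expected (λ _ → false)
  expected-empty a b = sym (begin
    (Q a b + through none a b) ∸ (Q b a + through none b a)
      ≡⟨ cong₂ (λ s t → (Q a b + s) ∸ (Q b a + t)) (no-paths a b) (no-paths b a) ⟩
    (Q a b + 0) ∸ (Q b a + 0)
      ≡⟨ cong₂ _∸_ (+-identityʳ (Q a b)) (+-identityʳ (Q b a)) ⟩
    Q a b ∸ Q b a
      ≡⟨ net-arrows isQ a b ⟩
    Q a b ∎)
    where
    none : Fin n → Bool
    none _ = false
    no-paths : ∀ x y → through none x y ≡ 0
    no-paths x y = sumFin-zero {n} (λ _ → refl)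

  insert : (Fin n → Bool) → Fin n → Fin n → Bool
  insert d v w = d w ∨ does (w ≟ v)

  insert-member : ∀ d v → insert d v v ≡ true
  insert-member d v rewrite dec-true (v ≟ v) refl = ∨-zeroʳ (d v)

  insert-other : ∀ d {v w} → w ≢ v → insert d v w ≡ d w
  insert-other d {v} {w} w≢v rewrite dec-false (w ≟ v) w≢v = ∨-identityʳ (d w)

  insert-InClass : ∀ {d v} → InClass d → c v ≡ true → InClass (insert d v)
  insert-InClass {d} {v} sub cv w _ with d w in dw | w ≟ v
  ... | true | _ = sub w dw
  ... | false | yes refl = cv

  through-insert : ∀ {d v} → d v ≡ false →
                   ∀ a b → through (insert d v) a b ≡ through d a b + Q a v * Q v b
  through-insert {d} {v} dv a b = begin
    through (insert d v) a b
      ≡⟨ sumFin-cong split ⟩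
    sumFin (λ w → (if d w then Q a w * Q w b else 0) + (if does (w ≟ v) then Q a w * Q w b else 0))
      ≡⟨ sumFin-+ (λ w → if d w then Q a w * Q w b else 0)
                  (λ w → if does (w ≟ v) then Q a w * Q w b else 0) ⟩
    through d a b + sumFin (λ w → if does (w ≟ v) then Q a w * Q w b else 0)
      ≡⟨ cong (through d a b +_) (sumFin-single (λ w → Q a w * Q w b) v) ⟩
    through d a b + Q a v * Q v b ∎
    where
    split : ∀ w → (if d w ∨ does (w ≟ v) then Q a w * Q w b else 0)
                ≡ (if d w then Q a w * Q w b else 0) + (if does (w ≟ v) then Q a w * Q w b else 0)
    split w with w ≟ v
    ... | yes refl rewrite dv = refl
    ... | no _ with d w
    ...   | true = sym (+-identityʳ _)
    ...   | false = refl

  weight-insert : ∀ d {v a b} → d v ≡ false → a ≢ v → b ≢ v →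
                  weight d a b + Q a v * Q v b ≡ weight (insert d v) a b
  weight-insert d {v} {a} {b} dv a≢v b≢v = begin
    (reversed d a b + through d a b) + Q a v * Q v b
      ≡⟨ +-assoc (reversed d a b) _ _ ⟩
    reversed d a b + (through d a b + Q a v * Q v b)
      ≡⟨ cong₂ _+_ (reversed-endpoints d (insert d v) (sym (insert-other d a≢v))
                                                      (sym (insert-other d b≢v)))
                   (sym (through-insert dv a b)) ⟩
    reversed (insert d v) a b + through (insert d v) a b ∎

  mutation-step : ∀ {d v R} → InClass d → c v ≡ true → d v ≡ false →
                  R ≐ expected d → mutate v R ≐ expected (insert d v)
  mutation-step {d} {v} {R} sub cv dv R≐ a b = by-position a b (a ≟ v) (b ≟ v)
    where
    into : ∀ x → R x v ≡ Q x v
    into x = trans (R≐ x v) (proj₁ (expected-fresh sub cv dv x))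

    out-of : ∀ x → R v x ≡ Q v x
    out-of x = trans (R≐ v x) (proj₂ (expected-fresh sub cv dv x))

    at-v : ∀ x → expected (insert d v) v x ≡ Q x v × expected (insert d v) x v ≡ Q v x
    at-v = expected-member (insert-InClass sub cv) (insert-member d v)

    by-position : ∀ a b → Dec (a ≡ v) → Dec (b ≡ v) → mutate v R a b ≡ expected (insert d v) a b
    by-position .v b (yes refl) _ = begin
      mutate v R v b            ≡⟨ mutate-source v R b ⟩
      R b v                     ≡⟨ into b ⟩
      Q b v                     ≡⟨ proj₁ (at-v b) ⟨
      expected (insert d v) v b ∎
    by-position a .v (no _) (yes refl) = begin
      mutate v R a v            ≡⟨ mutate-target v R a ⟩
      R v a                     ≡⟨ out-of a ⟩
      Q v a                     ≡⟨ proj₂ (at-v a) ⟨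
      expected (insert d v) a v ∎
    by-position a b (no a≢v) (no b≢v) = begin
      mutate v R a b
        ≡⟨ mutate-away R a≢v b≢v ⟩
      (R a b + R a v * R v b) ∸ (R b a + R b v * R v a)
        ≡⟨ cong₂ _∸_ (cong₂ _+_ (R≐ a b) (cong₂ _*_ (into a) (out-of b)))
                     (cong₂ _+_ (R≐ b a) (cong₂ _*_ (into b) (out-of a))) ⟩
      (expected d a b + Q a v * Q v b) ∸ (expected d b a + Q b v * Q v a)
        ≡⟨ cancel-then-add (weight d a b) (weight d b a) _ _ ⟩
      (weight d a b + Q a v * Q v b) ∸ (weight d b a + Q b v * Q v a)
        ≡⟨ cong₂ _∸_ (weight-insert d dv a≢v b≢v) (weight-insert d dv b≢v a≢v) ⟩
      expected (insert d v) a b ∎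

  -- While the list L remains to be traversed, the vertices of C outside L
  -- are the ones already mutated.
  doneBefore : List (Fin n) → Fin n → Bool
  doneBefore L w = c w ∧ not (does (w ∈? L))

  doneBefore-InClass : ∀ L → InClass (doneBefore L)
  doneBefore-InClass L w _ with c w
  ... | true = refl

  doneBefore-head : ∀ v L → doneBefore (v ∷ L) v ≡ false
  doneBefore-head v L = begin
    c v ∧ not (does (v ≟ v) ∨ does (v ∈? L))
      ≡⟨ cong (λ m → c v ∧ not (m ∨ does (v ∈? L))) (dec-true (v ≟ v) refl) ⟩
    c v ∧ false
      ≡⟨ ∧-zeroʳ (c v) ⟩
    false ∎

  doneBefore-mutated : ∀ {v} L → c v ≡ true → does (v ∈? L) ≡ false →
                       ∀ w → insert (doneBefore (v ∷ L)) v w ≡ doneBefore L w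
  doneBefore-mutated {v} L cv v∉L w with w ≟ v
  ... | yes refl = trans (∨-zeroʳ _) (sym (cong₂ (λ x m → x ∧ not m) cv v∉L))
  ... | no _ = ∨-identityʳ _

  doneBefore-skipped : ∀ {v} L → c v ≡ false → ∀ w → doneBefore (v ∷ L) w ≡ doneBefore L w
  doneBefore-skipped {v} L cv w with w ≟ v
  ... | yes refl rewrite cv = refl
  ... | no _ = refl

  step : Quiver n → Fin n → Quiver n
  step R v = if c v then mutate v R else R

  traverse : ∀ L R → Unique L → R ≐ expected (doneBefore L) → foldl step R L ≐ expected c
  traverse [] R _ R≐ a b =
    trans (R≐ a b) (expected-cong (doneBefore []) c (λ w → ∧-identityʳ (c w)) a b)
  traverse (v ∷ L) R (v∉L ∷ unique) R≐ with c v in cv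
  ... | true = traverse L (mutate v R) unique λ a b →
      trans (mutation-step (doneBefore-InClass (v ∷ L)) cv (doneBefore-head v L) R≐ a b)
            (expected-cong (insert (doneBefore (v ∷ L)) v) (doneBefore L)
                           (doneBefore-mutated L cv v-not-later) a b)
    where
    v-not-later : does (v ∈? L) ≡ false
    v-not-later = dec-false (v ∈? L) (λ v∈L → All.lookup v∉L v∈L refl)
  ... | false = traverse L R unique λ a b →
      trans (R≐ a b) (expected-cong (doneBefore (v ∷ L)) (doneBefore L) (doneBefore-skipped L cv) a b)

  mutateAll-expected : mutateAll c Q ≐ expected c
  mutateAll-expected = traverse (allFin n) Q (allFin⁺ n) λ a b →
    trans (expected-empty a b) (expected-cong (λ _ → false) (doneBefore (allFin n)) nothing-done a b)
    where
    nothing-done : ∀ w → false ≡ doneBefore (allFin n) w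
    nothing-done w = begin
      false
        ≡⟨ ∧-zeroʳ (c w) ⟨
      c w ∧ not true
        ≡⟨ cong (λ m → c w ∧ not m) (dec-true (w ∈? allFin n) (∈-allFin w)) ⟨
      c w ∧ not (does (w ∈? allFin n)) ∎

  mutateAll-touching : ∀ a b → c a ≡ true ⊎ c b ≡ true → mutateAll c Q a b ≡ Q b a
  mutateAll-touching a b touch = begin
    mutateAll c Q a b  ≡⟨ mutateAll-expected a b ⟩
    expected c a b     ≡⟨ expected-touching a b (λ _ in-C → in-C) touch ⟩
    reversed c a b     ≡⟨ reversed-member c a b touch ⟩
    Q b a              ∎

  -- For a ∉ C every 2-path from a has its middle vertex in C.
  through-outside : ∀ {a} b → c a ≡ false → through c a b ≡ paths2 Q a b
  through-outside {a} b ca = sumFin-cong middle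
    where
    middle : ∀ w → (if c w then Q a w * Q w b else 0) ≡ Q a w * Q w b
    middle w with c w in cw
    ... | true = refl
    ... | false rewrite no-arrow (trans ca (sym cw)) = refl

  mutateAll-outside : ∀ {a b} → c a ≡ false → c b ≡ false →
                      mutateAll c Q a b ≡ paths2 Q a b ∸ paths2 Q b a
  mutateAll-outside {a} {b} ca cb =
    trans (mutateAll-expected a b) (cong₂ _∸_ (weight-outside ca cb) (weight-outside cb ca))
    where
    weight-outside : ∀ {x y} → c x ≡ false → c y ≡ false → weight c x y ≡ paths2 Q x y
    weight-outside {x} {y} cx cy rewrite cx | cy | no-arrow (trans cx (sym cy)) = through-outside y cx

  SymmetricOutside : Set
  SymmetricOutside = ∀ u v → c u ≡ false → c v ≡ false → paths2 Q u v ≡ paths2 Q v u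

  mutateAll-opposite⇔ : (mutateAll c Q ≐ opposite Q) ⇔ SymmetricOutside
  mutateAll-opposite⇔ = mk⇔ symmetric opposed
    where
    symmetric : mutateAll c Q ≐ opposite Q → SymmetricOutside
    symmetric μ≐ u v cu cv =
      ≤-antisym (m∸n≡0⇒m≤n (no-surplus u v cu cv)) (m∸n≡0⇒m≤n (no-surplus v u cv cu))
      where
      no-surplus : ∀ x y → c x ≡ false → c y ≡ false → paths2 Q x y ∸ paths2 Q y x ≡ 0
      no-surplus x y cx cy = begin
        paths2 Q x y ∸ paths2 Q y x  ≡⟨ mutateAll-outside cx cy ⟨
        mutateAll c Q x y            ≡⟨ μ≐ x y ⟩
        Q y x                        ≡⟨ no-arrow (trans cy (sym cx)) ⟩
        0                            ∎

    opposed : SymmetricOutside → mutateAll c Q ≐ opposite Q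
    opposed sym-paths u v with c u in cu | c v in cv
    ... | true | _ = mutateAll-touching u v (inj₁ cu)
    ... | false | true = mutateAll-touching u v (inj₂ cv)
    ... | false | false = begin
      mutateAll c Q u v            ≡⟨ mutateAll-outside cu cv ⟩
      paths2 Q u v ∸ paths2 Q v u  ≡⟨ cong (_∸ paths2 Q v u) (sym-paths u v cu cv) ⟩
      paths2 Q v u ∸ paths2 Q v u  ≡⟨ n∸n≡0 (paths2 Q v u) ⟩
      0                            ≡⟨ no-arrow (trans cv (sym cu)) ⟨
      Q v u                        ∎

corollary2p2 : ∀ {n : ℕ} (Q : Quiver n) (ε : Fin n → Bool)
    → IsQuiver Q → IsBipartition Q ε
    → Recurrent Q ε ⇔ (∀ (u v : Fin n) → ε u ≡ ε v → paths2 Q u v ≡ paths2 Q v u)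
corollary2p2 {n} Q ε isQ bip = mk⇔ symmetric recurrent
  where
  bip-white : IsBipartition Q (not ∘ ε)
  bip-white u v Quv≢0 same = bip u v Quv≢0 (not-injective same)

  module Black = ColourClass Q ε isQ bip
  module White = ColourClass Q (not ∘ ε) isQ bip-white

  symmetric : Recurrent Q ε → ∀ u v → ε u ≡ ε v → paths2 Q u v ≡ paths2 Q v u
  symmetric (μ•≐ , μ∘≐) u v same = by-colour (ε u) refl
    where
    by-colour : ∀ b → ε u ≡ b → paths2 Q u v ≡ paths2 Q v u
    by-colour true  εu = Equivalence.to White.mutateAll-opposite⇔ μ∘≐ u v
                           (cong not εu) (cong not (trans (sym same) εu))
    by-colour false εu = Equivalence.to Black.mutateAll-opposite⇔ μ•≐ u v
                           εu (trans (sym same) εu)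

  recurrent : (∀ u v → ε u ≡ ε v → paths2 Q u v ≡ paths2 Q v u) → Recurrent Q ε
  recurrent sym-paths =
    Equivalence.from Black.mutateAll-opposite⇔ (λ u v εu εv → sym-paths u v (trans εu (sym εv))) ,
    Equivalence.from White.mutateAll-opposite⇔
      (λ u v εu εv → sym-paths u v (not-injective (trans εu (sym εv))))
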